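{- Algorithm 2 (described in the context) is a 4-approximation algorithm for min-sum 2-TSP: for every instance, the returned tours $C_b,C_r$ satisfy $c(C_b)+c(C_r)\le 4\cdot\mathrm{OPT}$, where $\mathrm{OPT}$ is the minimum of $c(R)+c(B)$ over all feasible solutions.
   Context: An instance of 2-TSP consists of $2n$ nodes $V$ (with $n$ even) partitioned into $n$ pairs $\{p_i,q_i\}$, with metric edge weights $c$ on the complete graph on $V$ (nonnegative, triangle inequality). A feasible solution colors one node of each pair red and the other blue, and consists of a tour (Hamiltonian cycle) $R$ on the red nodes and a tour $B$ on the blue nodes; the min-sum objective minimizes $c(R)+c(B)$, with $c(F)$ the total weight of edge set $F$. Algorithm 2: (1) compute a minimum spanning tree $T$ on all $2n$ nodes; (2) delete a maximum-weight edge $e_\times$ of $T$, obtaining trees $T_L,T_R$ on node sets $V_L,V_R$; (3) for each pair with one node in $V_L$ and the other in $V_R$, color the node in $V_L$ blue and the node in $V_R$ red; (4) for every other pair, assign its nodes arbitrary distinct colors; (5) compute a tour $C$ of all nodes from $T$ by edge-doubling (traverse an Eulerian circuit of $T$ with every edge doubled, shortcutting repeated nodes); (6) for each color $c\in\{b,r\}$, let $C_c$ be the tour of the color-$c$ nodes obtained by shortcutting $C$ (visiting the color-$c$ nodes in the order of $C$); return $\{C_b,C_r\}$.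
   Formalization: The metric edge weights $c$ take rational values. -}

module Defs where

open import Data.Nat using (ℕ; _*_; _∸_)
open import Data.Bool using (Bool; true; false; not)
open import Data.Fin using (Fin)
open import Data.Product using (_×_; _,_; Σ; ∃)
open import Data.Sum using (_⊎_)
open import Data.List using (List; []; _∷_; _++_; [_]; length; filter; deduplicate)
open import Data.List.Membership.Propositional using (_∈_)
open import Data.List.Relation.Unary.Any using (_─_)
open import Data.List.Relation.Unary.Unique.Propositional using (Unique)
open import Data.List.Relation.Binary.Pointwise using (Pointwise)
open import Data.List.Relation.Binary.Permutation.Propositional using (_↭_)
open import Data.Rational using (ℚ; 0ℚ; _+_; _≤_)
open import Relation.Binary.PropositionalEquality using (_≡_; _≢_)
open import Relation.Binary.Construct.Closure.ReflexiveTransitive using (Star)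
open import Relation.Nullary using (Dec; yes; no)
open import Data.Fin.Properties using () renaming (_≟_ to _≟F_)
open import Data.Bool.Properties using () renaming (_≟_ to _≟B_)
open import Data.Product.Properties using (≡-dec)
open import Relation.Binary.Definitions using (DecidableEquality)

-- Nodes of an instance with n pairs: (i , false) = p_i, (i , true) = q_i.
V : ℕ → Set
V n = Fin n × Bool

Edge : ℕ → Set
Edge n = V n × V n

_≟V_ : ∀ {n} → DecidableEquality (V n)
_≟V_ = ≡-dec _≟F_ _≟B_

record IsMetric {n : ℕ} (c : V n → V n → ℚ) : Set where
  field
    nonneg   : ∀ x y → 0ℚ ≤ c x y
    symmetric : ∀ x y → c x y ≡ c y x
    triangle : ∀ x y z → c x z ≤ c x y + c y z

weight : ∀ {n} → (V n → V n → ℚ) → Edge n → ℚ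
weight c (u , v) = c u v

edgeCost : ∀ {n} → (V n → V n → ℚ) → List (Edge n) → ℚ
edgeCost c [] = 0ℚ
edgeCost c (e ∷ es) = weight c e + edgeCost c es

pathCost : ∀ {n} → (V n → V n → ℚ) → List (V n) → ℚ
pathCost c [] = 0ℚ
pathCost c (x ∷ []) = 0ℚ
pathCost c (x ∷ y ∷ ys) = c x y + pathCost c (y ∷ ys)

tourCost : ∀ {n} → (V n → V n → ℚ) → List (V n) → ℚ
tourCost c [] = 0ℚ
tourCost c (x ∷ xs) = pathCost c (x ∷ xs ++ [ x ])

consecutive : ∀ {A : Set} → List A → List (A × A)
consecutive [] = []
consecutive (x ∷ []) = []
consecutive (x ∷ y ∷ ys) = (x , y) ∷ consecutive (y ∷ ys)

closedWalkSteps : ∀ {A : Set} → List A → List (A × A)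
closedWalkSteps [] = []
closedWalkSteps (x ∷ xs) = consecutive (x ∷ xs ++ [ x ])

Adj : ∀ {n} → List (Edge n) → V n → V n → Set
Adj E x y = ((x , y) ∈ E) ⊎ ((y , x) ∈ E)

Reach : ∀ {n} → List (Edge n) → V n → V n → Set
Reach E = Star (Adj E)

Connected : ∀ {n} → List (Edge n) → Set
Connected {n} E = ∀ (x y : V n) → Reach E x y

IsSpanningTree : ∀ {n} → List (Edge n) → Set
IsSpanningTree {n} E = Connected E × length E ≡ 2 * n ∸ 1

IsMST : ∀ {n} → (V n → V n → ℚ) → List (Edge n) → Set
IsMST c T = IsSpanningTree T × (∀ T' → IsSpanningTree T' → edgeCost c T ≤ edgeCost c T')

data Color : Set where
  red blue : Color

_≟C_ : DecidableEquality Color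
red ≟C red = yes Relation.Binary.PropositionalEquality.refl
red ≟C blue = no (λ ())
blue ≟C red = no (λ ())
blue ≟C blue = yes Relation.Binary.PropositionalEquality.refl

ValidColoring : ∀ {n} → (V n → Color) → Set
ValidColoring {n} col = ∀ (i : Fin n) → col (i , false) ≢ col (i , true)

-- Steps (2)-(3): with e = (u , v) ∈ T deleted, V_L = nodes reachable from u and
-- V_R = nodes reachable from v in T - e; a pair split between V_L and V_R has
-- its V_L node blue and its V_R node red.
RespectsSplit : ∀ {n} (T : List (Edge n)) {e : Edge n} → e ∈ T → (V n → Color) → Set
RespectsSplit {n} T {u , v} e∈T col =
  ∀ (i : Fin n) (b : Bool) →
    Reach (T ─ e∈T) u (i , b) → Reach (T ─ e∈T) v (i , not b) →
    (col (i , b) ≡ blue) × (col (i , not b) ≡ red)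

-- W = w0 w1 ... w(k-1) is an Eulerian circuit (closed walk) of the multigraph
-- obtained from T by doubling each edge: its steps are, as a multiset, the edges
-- of T ++ T, each traversed in one of its two orientations.
IsDoubledEulerCircuit : ∀ {n} → List (Edge n) → List (V n) → Set
IsDoubledEulerCircuit {n} T W =
  Σ (List (Edge n)) λ D →
    Pointwise (λ d e → (d ≡ e) ⊎ (d ≡ (Data.Product.proj₂ e , Data.Product.proj₁ e))) D (T ++ T)
    × (closedWalkSteps W ↭ D)

-- Step (5): tour C from the Euler circuit by shortcutting repeated nodes.
shortcutAll : ∀ {n} → List (V n) → List (V n)
shortcutAll = deduplicate _≟V_

-- Step (6): tour of the color-k nodes, visiting them in the order of C.
shortcutColor : ∀ {n} → (V n → Color) → Color → List (V n) → List (V n)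
shortcutColor col k C = filter (λ v → col v ≟C k) C

-- X is a tour (Hamiltonian cycle, as a cyclic order) on the nodes of color k
IsTourOn : ∀ {n} → (V n → Color) → Color → List (V n) → Set
IsTourOn {n} col k X = Unique X × (∀ (v : V n) → (v ∈ X → col v ≡ k) × (col v ≡ k → v ∈ X))

module Submission where

-- Compare the algorithm's cost ALG with an arbitrary feasible solution, a red tour R and a
-- blue tour B of total cost OPT. Let e = (u , v) be the deleted heaviest edge of the minimum
-- spanning tree T and T⁻ = T - e. Two upper bounds on ALG:
--   * ALG ≤ 4·c(T) always: the Euler circuit of the doubled tree costs 2·c(T), and each colour
--     tour is a shortcut of it (DoubledTree);
--   * ALG ≤ 2·c(T⁻) if every pair is split by e: contracting the opposite side to a point
--     makes each colour tour a shortcut of the doubled tree in a contracted metric (SplitBound).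
-- Two lower bounds on OPT, from minimality of T (exchange, two-paths-bound):
--   * c(T⁻) ≤ OPT, as two Hamiltonian paths of the colour classes plus a red–blue tree edge
--     form a spanning tree;
--   * c(T) ≤ OPT if some step of R or B reconnects the two sides of T⁻, as that step weighs at
--     least c(e) and can pay for e.
-- If no step reconnects, each tour stays on one side, the two tours lie on opposite sides and
-- every pair is split by e (Analysis.NoReconnection).

open import Defs
open import Algebra.Bundles using (CommutativeMonoid)
open import Data.Bool using (true; false; not)
open import Data.Bool.Properties using (not-involutive)
open import Data.Empty using (⊥; ⊥-elim)
open import Data.Fin as Fin using (Fin)
open import Data.Integer using (+_)
open import Data.List using (List; []; _∷_; _++_; [_]; length; map; allFin)
open import Data.List.Properties
  using (++-assoc; ++-identityʳ; ∷-injective; length-++; length-map; length-tabulate; length-removeAt′)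
open import Data.List.Membership.Propositional using (_∈_)
open import Data.List.Membership.Propositional.Properties
  using (∈-++⁺ˡ; ∈-++⁺ʳ; ∈-++⁻; ∈-map⁺; ∈-map⁻; ∈-allFin; ∈-∃++; ∈-filter⁺; ∈-filter⁻; ∈-deduplicate⁺)
open import Data.List.Membership.Propositional.Properties.WithK using (unique∧set⇒bag)
open import Data.List.Relation.Binary.BagAndSetEquality using (∼bag⇒↭)
open import Data.List.Relation.Binary.Permutation.Propositional
  using (_↭_; refl; prep; swap; ↭-sym; ↭⇒↭ₛ) renaming (trans to ↭-trans)
open import Data.List.Relation.Binary.Permutation.Propositional.Properties
  using (∈-resp-↭; ↭-length; ++-comm)
import Data.List.Relation.Binary.Permutation.Setoid.Properties as SetoidPermutation
open import Data.List.Relation.Binary.Pointwise using (Pointwise; []; _∷_)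
open import Data.List.Relation.Binary.Sublist.Propositional using (_⊆_; []; _∷_; _∷ʳ_; ⊆-trans)
open import Data.List.Relation.Binary.Sublist.Propositional.Properties using (filter-⊆; ++⁺ʳ)
open import Data.List.Relation.Unary.All as All using (_∷_)
open import Data.List.Relation.Unary.AllPairs using (_∷_)
open import Data.List.Relation.Unary.Any using (here; there; _─_; index)
open import Data.List.Relation.Unary.Unique.Propositional using (Unique)
import Data.List.Relation.Unary.Unique.Propositional.Properties as Unique
open import Data.List.Relation.Unary.Unique.DecPropositional.Properties using (deduplicate-!)
open import Data.Nat as ℕ using (ℕ; zero; suc; _∸_)
import Data.Nat.Properties as ℕₚ
open import Data.Nat.Divisibility using (_∣_; divides)
open import Data.Product using (_×_; _,_; ∃; ∃₂; proj₁; proj₂)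
import Data.Product as Product
open import Data.Rational using (ℚ; 0ℚ; 1ℚ; _+_; _*_; -_; _≤_; _/_; _≤?_)
open import Data.Rational.Properties
  using (≤-refl; ≤-reflexive; ≤-trans; +-mono-≤; +-monoˡ-≤; +-monoʳ-≤; +-comm; +-assoc; +-identityˡ; +-identityʳ;
         +-inverseʳ; *-identityˡ; *-distribʳ-+; +-0-commutativeMonoid; module ≤-Reasoning)
open import Data.Sum using (_⊎_; inj₁; inj₂)
import Data.Sum as Sum
open import Function.Base using (id)
open import Function.Bundles using (mk⇔)
open import Relation.Binary.Construct.Closure.ReflexiveTransitive using (ε; _◅_; _◅◅_)
import Relation.Binary.Construct.Closure.ReflexiveTransitive as Star
open import Relation.Binary.PropositionalEquality
  using (_≡_; _≢_; refl; sym; trans; cong; cong₂; subst; subst₂; setoid; module ≡-Reasoning)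
open import Relation.Nullary using (¬_; Dec; yes; no)
open import Relation.Nullary.Decidable using (decidable-stable; ¬¬-excluded-middle)

open import Algebra.Properties.CommutativeSemigroup
  (CommutativeMonoid.commutativeSemigroup +-0-commutativeMonoid)
  using (interchange; x∙yz≈y∙xz; xy∙z≈xz∙y)

≤-+-nonneg : ∀ a {b} → 0ℚ ≤ b → a ≤ a + b
≤-+-nonneg a {b} 0≤b = subst (_≤ a + b) (+-identityʳ a) (+-monoʳ-≤ a 0≤b)

+-nonneg : ∀ {a b} → 0ℚ ≤ a → 0ℚ ≤ b → 0ℚ ≤ a + b
+-nonneg {a} {b} 0≤a 0≤b = subst (_≤ a + b) (+-identityʳ 0ℚ) (+-mono-≤ 0≤a 0≤b)

+-cancelˡ-≤ : ∀ x a b → x + a ≤ x + b → a ≤ b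
+-cancelˡ-≤ x a b x+a≤x+b =
  subst₂ _≤_ (undo a) (undo b) (+-monoˡ-≤ (- x) (subst₂ _≤_ (+-comm x a) (+-comm x b) x+a≤x+b))
  where
  undo : ∀ y → y + x + - x ≡ y
  undo y = trans (+-assoc y x (- x)) (trans (cong (λ z → y + z) (+-inverseʳ x)) (+-identityʳ y))

four-times : ∀ x → (+ 4) / 1 * x ≡ (x + x) + (x + x)
four-times x = begin
  (1ℚ + 1ℚ + 1ℚ + 1ℚ) * x          ≡⟨ *-distribʳ-+ x (1ℚ + 1ℚ + 1ℚ) 1ℚ ⟩
  (1ℚ + 1ℚ + 1ℚ) * x + 1ℚ * x      ≡⟨ cong₂ _+_ (*-distribʳ-+ x (1ℚ + 1ℚ) 1ℚ) (*-identityˡ x) ⟩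
  (1ℚ + 1ℚ) * x + 1ℚ * x + x       ≡⟨ cong (λ y → y + 1ℚ * x + x) (*-distribʳ-+ x 1ℚ 1ℚ) ⟩
  1ℚ * x + 1ℚ * x + 1ℚ * x + x     ≡⟨ cong (λ y → y + y + y + x) (*-identityˡ x) ⟩
  x + x + x + x                    ≡⟨ +-assoc (x + x) x x ⟩
  (x + x) + (x + x)                ∎
  where open ≡-Reasoning

lastNode : ∀ {A : Set} → A → List A → A
lastNode x [] = x
lastNode x (y ∷ ys) = lastNode y ys

lastNode-∷ʳ : ∀ {A : Set} (x : A) ys z → lastNode x (ys ++ [ z ]) ≡ z
lastNode-∷ʳ x [] z = refl
lastNode-∷ʳ x (y ∷ ys) z = lastNode-∷ʳ y ys z

lastNode-∈ : ∀ {A : Set} (x : A) xs → lastNode x xs ∈ x ∷ xs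
lastNode-∈ x [] = here refl
lastNode-∈ x (y ∷ ys) = there (lastNode-∈ y ys)

consecutive-∷ʳ : ∀ {A : Set} (x : A) xs z →
  consecutive (x ∷ xs ++ [ z ]) ≡ consecutive (x ∷ xs) ++ [ (lastNode x xs , z) ]
consecutive-∷ʳ x [] z = refl
consecutive-∷ʳ x (y ∷ ys) z = cong ((x , y) ∷_) (consecutive-∷ʳ y ys z)

consecutive-ends : ∀ {A : Set} {s : A × A} xs → s ∈ consecutive xs → (proj₁ s ∈ xs) × (proj₂ s ∈ xs)
consecutive-ends (x ∷ y ∷ ys) (here refl) = here refl , there (here refl)
consecutive-ends (x ∷ y ∷ ys) (there s∈) = Product.map there there (consecutive-ends (y ∷ ys) s∈)

closedWalkSteps-ends : ∀ {A : Set} {s : A × A} xs → s ∈ closedWalkSteps xs → (proj₁ s ∈ xs) × (proj₂ s ∈ xs)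
closedWalkSteps-ends (x ∷ xs) s∈ = Product.map drop-last drop-last (consecutive-ends (x ∷ xs ++ [ x ]) s∈)
  where
  drop-last : ∀ {w} → w ∈ x ∷ xs ++ [ x ] → w ∈ x ∷ xs
  drop-last (here refl) = here refl
  drop-last (there w∈) = Sum.[ there , (λ { (here refl) → here refl }) ] (∈-++⁻ xs w∈)

consecutive-distinct : ∀ {A : Set} {s : A × A} xs → Unique xs → s ∈ consecutive xs → proj₁ s ≢ proj₂ s
consecutive-distinct (x ∷ y ∷ ys) ((x≢y ∷ _) ∷ _) (here refl) = x≢y
consecutive-distinct (x ∷ y ∷ ys) (_ ∷ unique) (there s∈) = consecutive-distinct (y ∷ ys) unique s∈

closedWalkSteps-distinct : ∀ {A : Set} {s : A × A} x y ys → Unique (x ∷ y ∷ ys) →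
                           s ∈ closedWalkSteps (x ∷ y ∷ ys) → proj₁ s ≢ proj₂ s
closedWalkSteps-distinct x y ys unique s∈ rewrite consecutive-∷ʳ x (y ∷ ys) x
  with ∈-++⁻ (consecutive (x ∷ y ∷ ys)) s∈
... | inj₁ s∈path = consecutive-distinct (x ∷ y ∷ ys) unique s∈path
closedWalkSteps-distinct x y ys (x∉ ∷ _) s∈ | inj₂ (here refl) =
  λ last≡x → All.lookup x∉ (lastNode-∈ y ys) (sym last≡x)

some-step : ∀ {A : Set} (x : A) xs → ∃ λ s → s ∈ closedWalkSteps (x ∷ xs)
some-step x [] = _ , here refl
some-step x (y ∷ ys) = _ , here refl

path-steps-⊆ : ∀ {A : Set} (x : A) xs {s} → s ∈ consecutive (x ∷ xs) → s ∈ closedWalkSteps (x ∷ xs)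
path-steps-⊆ x xs s∈ = subst (_ ∈_) (sym (consecutive-∷ʳ x xs x)) (∈-++⁺ˡ s∈)

closedWalkSteps-rotate₁ : ∀ {A : Set} (x y : A) ys →
  closedWalkSteps (y ∷ ys ++ [ x ]) ≡ consecutive (y ∷ ys ++ [ x ]) ++ [ (x , y) ]
closedWalkSteps-rotate₁ x y ys =
  trans (consecutive-∷ʳ y (ys ++ [ x ]) y)
        (cong (λ w → consecutive (y ∷ ys ++ [ x ]) ++ [ (w , y) ]) (lastNode-∷ʳ y ys x))

⊆-split : ∀ {A : Set} {s : A} {ss L} → (s ∷ ss) ⊆ L → ∃₂ λ pre rest → (L ≡ pre ++ s ∷ rest) × (ss ⊆ rest)
⊆-split (y ∷ʳ p) with ⊆-split p
... | pre , rest , refl , q = y ∷ pre , rest , refl , q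
⊆-split (refl ∷ p) = [] , _ , refl , p

two-entries : ∀ {A : Set} {x y : A} {L} → x ∈ L → y ∈ L → x ≢ y → ∃₂ λ a b → ∃ λ bs → L ≡ a ∷ b ∷ bs
two-entries {L = a ∷ b ∷ bs} _ _ _ = a , b , bs , refl
two-entries {L = a ∷ []} (here refl) (here refl) x≢y = ⊥-elim (x≢y refl)

pointwise-∈ : ∀ {A : Set} {R : A → A → Set} {D E : List A} {e} → Pointwise R D E → e ∈ E → ∃ λ d → (d ∈ D) × R d e
pointwise-∈ (r ∷ _) (here refl) = _ , here refl , r
pointwise-∈ (_ ∷ rs) (there e∈E) with pointwise-∈ rs e∈E
... | d , d∈D , r = d , there d∈D , r

∈-─ : ∀ {A : Set} {e s : A} {xs} (p : e ∈ xs) → s ∈ xs → (s ∈ (xs ─ p)) ⊎ (s ≡ e)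
∈-─ (here refl) (here refl) = inj₂ refl
∈-─ (here refl) (there q) = inj₁ q
∈-─ (there p) (here refl) = inj₁ (here refl)
∈-─ (there p) (there q) = Sum.map₁ there (∈-─ p q)

module WalkCost {n : ℕ} (d : V n → V n → ℚ) where
  open ≡-Reasoning

  edgeCost-++ : ∀ es fs → edgeCost d (es ++ fs) ≡ edgeCost d es + edgeCost d fs
  edgeCost-++ [] fs = sym (+-identityˡ (edgeCost d fs))
  edgeCost-++ (e ∷ es) fs = begin
    weight d e + edgeCost d (es ++ fs)               ≡⟨ cong (λ z → weight d e + z) (edgeCost-++ es fs) ⟩
    weight d e + (edgeCost d es + edgeCost d fs)     ≡⟨ +-assoc (weight d e) _ _ ⟨
    weight d e + edgeCost d es + edgeCost d fs       ∎

  edgeCost-↭ : ∀ {es fs} → es ↭ fs → edgeCost d es ≡ edgeCost d fs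
  edgeCost-↭ refl = refl
  edgeCost-↭ (prep e p) = cong (λ z → weight d e + z) (edgeCost-↭ p)
  edgeCost-↭ (swap e f p) =
    trans (x∙yz≈y∙xz (weight d e) (weight d f) _) (cong (λ z → weight d f + (weight d e + z)) (edgeCost-↭ p))
  edgeCost-↭ (↭-trans p q) = trans (edgeCost-↭ p) (edgeCost-↭ q)

  edgeCost-─ : ∀ {e es} (p : e ∈ es) → edgeCost d es ≡ weight d e + edgeCost d (es ─ p)
  edgeCost-─ (here refl) = refl
  edgeCost-─ {e} (there {x = f} p) =
    trans (cong (λ z → weight d f + z) (edgeCost-─ p)) (x∙yz≈y∙xz (weight d f) (weight d e) _)

  pathCost-edges : ∀ xs → pathCost d xs ≡ edgeCost d (consecutive xs)
  pathCost-edges [] = refl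
  pathCost-edges (x ∷ []) = refl
  pathCost-edges (x ∷ y ∷ ys) = cong (λ z → d x y + z) (pathCost-edges (y ∷ ys))

  tourCost-edges : ∀ xs → tourCost d xs ≡ edgeCost d (closedWalkSteps xs)
  tourCost-edges [] = refl
  tourCost-edges (x ∷ xs) = pathCost-edges (x ∷ xs ++ [ x ])

  pathCost-∷ʳ : ∀ x xs z → pathCost d (x ∷ xs ++ [ z ]) ≡ pathCost d (x ∷ xs) + d (lastNode x xs) z
  pathCost-∷ʳ x [] z = trans (+-identityʳ (d x z)) (sym (+-identityˡ (d x z)))
  pathCost-∷ʳ x (y ∷ ys) z = begin
    d x y + pathCost d (y ∷ ys ++ [ z ])                      ≡⟨ cong (λ z → d x y + z) (pathCost-∷ʳ y ys z) ⟩
    d x y + (pathCost d (y ∷ ys) + d (lastNode y ys) z)       ≡⟨ +-assoc (d x y) _ _ ⟨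
    d x y + pathCost d (y ∷ ys) + d (lastNode y ys) z         ∎

  tourCost-close : ∀ x xs → tourCost d (x ∷ xs) ≡ pathCost d (x ∷ xs) + d (lastNode x xs) x
  tourCost-close x xs = pathCost-∷ʳ x xs x

  tourCost-rotate₁ : ∀ x xs → tourCost d (x ∷ xs) ≡ tourCost d (xs ++ [ x ])
  tourCost-rotate₁ x [] = refl
  tourCost-rotate₁ x (y ∷ ys) = begin
    d x y + pathCost d (y ∷ ys ++ [ x ])
      ≡⟨ +-comm (d x y) _ ⟩
    pathCost d (y ∷ ys ++ [ x ]) + d x y
      ≡⟨ cong (λ w → pathCost d (y ∷ ys ++ [ x ]) + d w y) (lastNode-∷ʳ y ys x) ⟨
    pathCost d (y ∷ ys ++ [ x ]) + d (lastNode y (ys ++ [ x ])) y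
      ≡⟨ pathCost-∷ʳ y (ys ++ [ x ]) y ⟨
    tourCost d (y ∷ ys ++ [ x ])
      ∎

  tourCost-rotate : ∀ xs ys → tourCost d (xs ++ ys) ≡ tourCost d (ys ++ xs)
  tourCost-rotate [] ys = cong (tourCost d) (sym (++-identityʳ ys))
  tourCost-rotate (x ∷ xs) ys = begin
    tourCost d (x ∷ xs ++ ys)              ≡⟨ tourCost-rotate₁ x (xs ++ ys) ⟩
    tourCost d ((xs ++ ys) ++ [ x ])       ≡⟨ cong (tourCost d) (++-assoc xs ys [ x ]) ⟩
    tourCost d (xs ++ ys ++ [ x ])         ≡⟨ tourCost-rotate xs (ys ++ [ x ]) ⟩
    tourCost d ((ys ++ [ x ]) ++ xs)       ≡⟨ cong (tourCost d) (++-assoc ys [ x ] xs) ⟩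
    tourCost d (ys ++ x ∷ xs)              ∎

edgeCost-mono : ∀ {n} {d d′ : V n → V n → ℚ} es → (∀ s → s ∈ es → weight d s ≤ weight d′ s) →
                edgeCost d es ≤ edgeCost d′ es
edgeCost-mono [] _ = ≤-refl
edgeCost-mono (e ∷ es) d≤d′ = +-mono-≤ (d≤d′ e (here refl)) (edgeCost-mono es (λ s s∈es → d≤d′ s (there s∈es)))

edgeCost-+ : ∀ {n} (d d′ : V n → V n → ℚ) es →
             edgeCost (λ x y → d x y + d′ x y) es ≡ edgeCost d es + edgeCost d′ es
edgeCost-+ d d′ [] = sym (+-identityˡ 0ℚ)
edgeCost-+ d d′ ((x , y) ∷ es) =
  trans (cong (λ z → d x y + d′ x y + z) (edgeCost-+ d d′ es)) (interchange (d x y) (d′ x y) _ _)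

module MetricWalks {n : ℕ} {d : V n → V n → ℚ} (met : IsMetric d) where
  open IsMetric met
  open WalkCost d

  edgeCost-reorient : ∀ {fs es} → Pointwise (λ f e → (f ≡ e) ⊎ (f ≡ (proj₂ e , proj₁ e))) fs es →
                      edgeCost d fs ≡ edgeCost d es
  edgeCost-reorient [] = refl
  edgeCost-reorient (inj₁ refl ∷ ps) = cong (λ z → weight d _ + z) (edgeCost-reorient ps)
  edgeCost-reorient (inj₂ refl ∷ ps) = cong₂ _+_ (symmetric _ _) (edgeCost-reorient ps)

  pathCost-nonneg : ∀ xs → 0ℚ ≤ pathCost d xs
  pathCost-nonneg [] = ≤-refl
  pathCost-nonneg (x ∷ []) = ≤-refl
  pathCost-nonneg (x ∷ y ∷ ys) = +-nonneg (nonneg x y) (pathCost-nonneg (y ∷ ys))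

  tourCost-nonneg : ∀ xs → 0ℚ ≤ tourCost d xs
  tourCost-nonneg [] = ≤-refl
  tourCost-nonneg (x ∷ xs) = pathCost-nonneg (x ∷ xs ++ [ x ])

  path≤tour : ∀ x xs → pathCost d (x ∷ xs) ≤ tourCost d (x ∷ xs)
  path≤tour x xs = subst (pathCost d (x ∷ xs) ≤_) (sym (tourCost-close x xs)) (≤-+-nonneg _ (nonneg _ _))

  skip-node : ∀ a y t rest → pathCost d (a ∷ t ∷ rest) ≤ pathCost d (a ∷ y ∷ t ∷ rest)
  skip-node a y t rest = ≤-trans (+-monoˡ-≤ (pathCost d (t ∷ rest)) (triangle a y t))
                                 (≤-reflexive (+-assoc (d a y) (d y t) (pathCost d (t ∷ rest))))

  path-shortcut : ∀ {xs ys} → xs ⊆ ys → ∀ a z → pathCost d (a ∷ xs ++ [ z ]) ≤ pathCost d (a ∷ ys ++ [ z ])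
  path-shortcut [] a z = ≤-refl
  path-shortcut {ys = y ∷ ys} (y ∷ʳ p) a z = ≤-trans (path-shortcut p a z) (skip ys)
    where
    skip : ∀ ts → pathCost d (a ∷ ts ++ [ z ]) ≤ pathCost d (a ∷ y ∷ ts ++ [ z ])
    skip [] = skip-node a y z []
    skip (t ∷ ts) = skip-node a y t (ts ++ [ z ])
  path-shortcut (refl ∷ p) a z = +-monoʳ-≤ (d a _) (path-shortcut p _ z)

  tour-shortcut : ∀ {S L} → S ⊆ L → tourCost d S ≤ tourCost d L
  tour-shortcut {[]} {L} _ = tourCost-nonneg L
  tour-shortcut {s ∷ ss} p with ⊆-split p
  ... | pre , rest , refl , q = ≤-trans (path-shortcut (++⁺ʳ pre q) s s)
                                        (≤-reflexive (tourCost-rotate (s ∷ rest) pre))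

-- The weight d with its diagonal set to zero. Metrics here may have d x x > 0; before merging
-- nodes by a contraction the diagonal is zeroed, so that merged nodes are at distance 0.
zeroDiagonal : ∀ {n} → (V n → V n → ℚ) → V n → V n → ℚ
zeroDiagonal d p q with p ≟V q
... | yes _ = 0ℚ
... | no _ = d p q

zeroDiagonal-refl : ∀ {n} (d : V n → V n → ℚ) p → zeroDiagonal d p p ≡ 0ℚ
zeroDiagonal-refl d p with p ≟V p
... | yes _ = refl
... | no p≢p = ⊥-elim (p≢p refl)

zeroDiagonal-≢ : ∀ {n} (d : V n → V n → ℚ) {p q} → p ≢ q → zeroDiagonal d p q ≡ d p q
zeroDiagonal-≢ d {p} {q} p≢q with p ≟V q
... | yes p≡q = ⊥-elim (p≢q p≡q)
... | no _ = refl

module ZeroDiagonal {n : ℕ} {d : V n → V n → ℚ} (met : IsMetric d) where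
  open IsMetric met

  zeroDiagonal-≤ : ∀ p q → zeroDiagonal d p q ≤ d p q
  zeroDiagonal-≤ p q with p ≟V q
  ... | yes _ = nonneg p q
  ... | no _ = ≤-refl

  zeroDiagonal-metric : IsMetric (zeroDiagonal d)
  zeroDiagonal-metric = record { nonneg = nonneg⁰ ; symmetric = symmetric⁰ ; triangle = triangle⁰ }
    where
    nonneg⁰ : ∀ p q → 0ℚ ≤ zeroDiagonal d p q
    nonneg⁰ p q with p ≟V q
    ... | yes _ = ≤-refl
    ... | no _ = nonneg p q

    symmetric⁰ : ∀ p q → zeroDiagonal d p q ≡ zeroDiagonal d q p
    symmetric⁰ p q with p ≟V q | q ≟V p
    ... | yes _ | yes _ = refl
    ... | yes p≡q | no q≢p = ⊥-elim (q≢p (sym p≡q))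
    ... | no p≢q | yes q≡p = ⊥-elim (p≢q (sym q≡p))
    ... | no _ | no _ = symmetric p q

    triangle⁰ : ∀ p q r → zeroDiagonal d p r ≤ zeroDiagonal d p q + zeroDiagonal d q r
    triangle⁰ p q r with p ≟V r
    ... | yes _ = +-nonneg (nonneg⁰ p q) (nonneg⁰ q r)
    ... | no p≢r with p ≟V q
    ...   | yes refl = subst (d p r ≤_) (sym (trans (+-identityˡ _) (zeroDiagonal-≢ d p≢r))) ≤-refl
    ...   | no p≢q with q ≟V r
    ...     | yes refl = subst (d p q ≤_) (sym (+-identityʳ (d p q))) ≤-refl
    ...     | no q≢r = triangle p q r

pullback-metric : ∀ {n} {d : V n → V n → ℚ} → IsMetric d → (π : V n → V n) → IsMetric (λ x y → d (π x) (π y))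
pullback-metric met π = record
  { nonneg = λ x y → nonneg (π x) (π y)
  ; symmetric = λ x y → symmetric (π x) (π y)
  ; triangle = λ x y z → triangle (π x) (π y) (π z)
  }
  where open IsMetric met

partner : ∀ {n} → V n → V n
partner (i , b) = (i , not b)

partner-≢ : ∀ {n} (x : V n) → x ≢ partner x
partner-≢ (i , false) ()
partner-≢ (i , true) ()

red≢blue : ∀ {k : Color} → k ≡ red → k ≢ blue
red≢blue refl ()

blue≢red : ∀ {k : Color} → k ≡ blue → k ≢ red
blue≢red refl ()

two-colours : ∀ {a b k : Color} → a ≢ b → a ≢ k → b ≡ k
two-colours {red} {red} a≢b _ = ⊥-elim (a≢b refl)
two-colours {blue} {blue} a≢b _ = ⊥-elim (a≢b refl)
two-colours {red} {blue} {blue} _ _ = refl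
two-colours {blue} {red} {red} _ _ = refl
two-colours {red} {blue} {red} _ a≢k = ⊥-elim (a≢k refl)
two-colours {blue} {red} {blue} _ a≢k = ⊥-elim (a≢k refl)

partner-colour : ∀ {n} {col : V n → Color} → ValidColoring col → ∀ x → col x ≢ col (partner x)
partner-colour valid (i , false) = valid i
partner-colour valid (i , true) = λ eq → valid i (sym eq)

partner-other : ∀ {n} {col : V n → Color} → ValidColoring col → ∀ {x k} → col x ≢ k → col (partner x) ≡ k
partner-other {col = col} valid {x} col-x≢k = two-colours (partner-colour {col = col} valid x) col-x≢k

pair-has-colour : ∀ {n} {col : V n → Color} → ValidColoring col → ∀ i k → ∃ λ b → col (i , b) ≡ k
pair-has-colour {col = col} valid i k with col (i , false) ≟C k
... | yes col-p = false , col-p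
... | no col-p≢k = true , two-colours (valid i) col-p≢k

two-of-each-colour : ∀ {n} {col : V n → Color} → ValidColoring col → ∀ {i₀ i₁} → i₀ ≢ i₁ →
                     ∀ k → ∃₂ λ x y → (x ≢ y) × (col x ≡ k) × (col y ≡ k)
two-of-each-colour {col = col} valid {i₀} {i₁} i₀≢i₁ k
  with pair-has-colour {col = col} valid i₀ k | pair-has-colour {col = col} valid i₁ k
... | b₀ , col₀ | b₁ , col₁ = (i₀ , b₀) , (i₁ , b₁) , (λ eq → i₀≢i₁ (cong proj₁ eq)) , col₀ , col₁

tour-nonempty : ∀ {n} {col : V n → Color} {k X} → ValidColoring col → Fin n → IsTourOn col k X →
                ∃₂ λ x xs → X ≡ x ∷ xs
tour-nonempty {X = x ∷ xs} _ _ _ = x , xs , refl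
tour-nonempty {col = col} {k = k} {X = []} valid i (_ , covers) with pair-has-colour {col = col} valid i k
... | b , col-k with proj₂ (covers (i , b)) col-k
... | ()

allNodes : ∀ n → List (V n)
allNodes n = map (_, false) (allFin n) ++ map (_, true) (allFin n)

allNodes-complete : ∀ {n} (x : V n) → x ∈ allNodes n
allNodes-complete (i , false) = ∈-++⁺ˡ (∈-map⁺ (_, false) (∈-allFin i))
allNodes-complete {n} (i , true) = ∈-++⁺ʳ (map (_, false) (allFin n)) (∈-map⁺ (_, true) (∈-allFin i))

allNodes-unique : ∀ n → Unique (allNodes n)
allNodes-unique n = Unique.++⁺ (Unique.map⁺ (cong proj₁) (Unique.allFin⁺ n))
                               (Unique.map⁺ (cong proj₁) (Unique.allFin⁺ n)) p≠q
  where
  p≠q : ∀ {x} → ¬ (x ∈ map (_, false) (allFin n) × x ∈ map (_, true) (allFin n))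
  p≠q (p , q) with ∈-map⁻ (_, false) p | ∈-map⁻ (_, true) q
  ... | _ , _ , refl | _ , _ , ()

length-allNodes : ∀ n → length (allNodes n) ≡ 2 ℕ.* n
length-allNodes n = begin
  length (allNodes n)
    ≡⟨ length-++ (map (_, false) (allFin n)) ⟩
  length (map (_, false) (allFin n)) ℕ.+ length (map (_, true) (allFin n))
    ≡⟨ cong₂ ℕ._+_ (length-map _ (allFin n)) (length-map _ (allFin n)) ⟩
  length (allFin n) ℕ.+ length (allFin n)
    ≡⟨ cong₂ ℕ._+_ (length-tabulate {n = n} id) (length-tabulate {n = n} id) ⟩
  n ℕ.+ n
    ≡⟨ cong (n ℕ.+_) (ℕₚ.+-identityʳ n) ⟨
  2 ℕ.* n
    ∎
  where open ≡-Reasoning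

tours-size : ∀ {n} {col : V n → Color} {R B} → IsTourOn col red R → IsTourOn col blue B →
             length R ℕ.+ length B ≡ 2 ℕ.* n
tours-size {n} {col} {R} {B} (R-unique , R-red) (B-unique , B-blue) = begin
  length R ℕ.+ length B    ≡⟨ length-++ R ⟨
  length (R ++ B)          ≡⟨ ↭-length R++B↭allNodes ⟩
  length (allNodes n)      ≡⟨ length-allNodes n ⟩
  2 ℕ.* n                  ∎
  where
  open ≡-Reasoning

  disjoint : ∀ {x} → ¬ (x ∈ R × x ∈ B)
  disjoint (x∈R , x∈B) with trans (sym (proj₁ (R-red _) x∈R)) (proj₁ (B-blue _) x∈B)
  ... | ()

  covered : ∀ x → x ∈ R ++ B
  covered x with col x in colx
  ... | red = ∈-++⁺ˡ (proj₂ (R-red x) colx)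
  ... | blue = ∈-++⁺ʳ R (proj₂ (B-blue x) colx)

  R++B↭allNodes : R ++ B ↭ allNodes n
  R++B↭allNodes = ∼bag⇒↭ (unique∧set⇒bag (Unique.++⁺ R-unique B-unique disjoint) (allNodes-unique n)
                                         (mk⇔ (λ _ → allNodes-complete _) (λ _ → covered _)))

tour-resp-↭ : ∀ {n} {col : V n → Color} {k X Y} → X ↭ Y → IsTourOn col k X → IsTourOn col k Y
tour-resp-↭ {n} X↭Y (X-unique , X-col) =
  SetoidPermutation.Unique-resp-↭ (setoid (V n)) (↭⇒↭ₛ X↭Y) X-unique ,
  λ v → (λ v∈Y → proj₁ (X-col v) (∈-resp-↭ (↭-sym X↭Y) v∈Y)) , (λ colv → ∈-resp-↭ X↭Y (proj₂ (X-col v) colv))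

Adj-sym : ∀ {n} {E : List (Edge n)} {x y} → Adj E x y → Adj E y x
Adj-sym (inj₁ p) = inj₂ p
Adj-sym (inj₂ p) = inj₁ p

Reach-sym : ∀ {n} {E : List (Edge n)} {x y} → Reach E x y → Reach E y x
Reach-sym = Star.reverse Adj-sym

Reach-mono : ∀ {n} {E F : List (Edge n)} → (∀ {s} → s ∈ E → s ∈ F) → ∀ {x y} → Reach E x y → Reach F x y
Reach-mono E⊆F = Star.map (Sum.map E⊆F E⊆F)

path-reach : ∀ {n} (x : V n) xs {y} → y ∈ x ∷ xs → Reach (consecutive (x ∷ xs)) x y
path-reach x [] (here refl) = ε
path-reach x (z ∷ zs) (here refl) = ε
path-reach x (z ∷ zs) (there y∈zs) = inj₁ (here refl) ◅ Reach-mono there (path-reach z zs y∈zs)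

length-consecutive : ∀ {A : Set} (x : A) xs → length (consecutive (x ∷ xs)) ≡ length xs
length-consecutive x [] = refl
length-consecutive x (z ∷ zs) = cong suc (length-consecutive z zs)

module DeleteEdge {n : ℕ} (T : List (Edge n)) {u v : V n} (e∈T : (u , v) ∈ T) where
  T⁻ : List (Edge n)
  T⁻ = T ─ e∈T

  Left Right : V n → Set
  Left = Reach T⁻ u
  Right = Reach T⁻ v

  sides : Connected T → ∀ x → Left x ⊎ Right x
  sides conn x = walk (inj₁ ε) (conn u x)
    where
    extend : ∀ {y z} → Left y ⊎ Right y → Adj T⁻ y z → Left z ⊎ Right z
    extend side adj = Sum.map (_◅◅ (adj ◅ ε)) (_◅◅ (adj ◅ ε)) side

    step : ∀ {y z} → Left y ⊎ Right y → Adj T y z → Left z ⊎ Right z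
    step side (inj₁ yz) with ∈-─ e∈T yz
    ... | inj₁ yz⁻ = extend side (inj₁ yz⁻)
    ... | inj₂ refl = inj₂ ε
    step side (inj₂ zy) with ∈-─ e∈T zy
    ... | inj₁ zy⁻ = extend side (inj₂ zy⁻)
    ... | inj₂ refl = inj₁ ε

    walk : ∀ {y z} → Left y ⊎ Right y → Reach T y z → Left z ⊎ Right z
    walk side ε = side
    walk side (adj ◅ path) = walk (step side adj) path

  Reconnects : Edge n → Set
  Reconnects g = Reach (T⁻ ++ [ g ]) u v

  crossing-reconnects : ∀ {a b} → (Left a × Right b) ⊎ (Right a × Left b) → Reconnects (a , b)
  crossing-reconnects (inj₁ (ua , vb)) =
    Reach-mono ∈-++⁺ˡ ua ◅◅ (inj₁ (∈-++⁺ʳ T⁻ (here refl)) ◅ ε) ◅◅ Reach-mono ∈-++⁺ˡ (Reach-sym vb)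
  crossing-reconnects (inj₂ (va , ub)) =
    Reach-mono ∈-++⁺ˡ ub ◅◅ (inj₂ (∈-++⁺ʳ T⁻ (here refl)) ◅ ε) ◅◅ Reach-mono ∈-++⁺ˡ (Reach-sym va)

  -- Exchange property of a minimum spanning tree: any edge g reconnecting T⁻ is at
  -- least as heavy as the deleted edge, since T⁻ ++ [ g ] is again a spanning tree.
  exchange : (c : V n → V n → ℚ) → IsMST c T → ∀ g → Reconnects g → c u v ≤ weight c g
  exchange c ((conn , size) , minimal) g reconnect = +-cancelˡ-≤ (edgeCost c T⁻) (c u v) (weight c g) (begin
    edgeCost c T⁻ + c u v                  ≡⟨ +-comm (edgeCost c T⁻) (c u v) ⟩
    c u v + edgeCost c T⁻                  ≡⟨ edgeCost-─ e∈T ⟨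
    edgeCost c T                           ≤⟨ minimal (T⁻ ++ [ g ]) (conn′ , size′) ⟩
    edgeCost c (T⁻ ++ [ g ])               ≡⟨ edgeCost-++ T⁻ [ g ] ⟩
    edgeCost c T⁻ + (weight c g + 0ℚ)      ≡⟨ cong (λ z → edgeCost c T⁻ + z) (+-identityʳ (weight c g)) ⟩
    edgeCost c T⁻ + weight c g             ∎)
    where
    open ≤-Reasoning
    open WalkCost c using (edgeCost-─; edgeCost-++)

    from-u : ∀ x → Reach (T⁻ ++ [ g ]) u x
    from-u x = Sum.[ Reach-mono ∈-++⁺ˡ , (λ vx → reconnect ◅◅ Reach-mono ∈-++⁺ˡ vx) ] (sides conn x)

    conn′ : Connected (T⁻ ++ [ g ])
    conn′ x y = Reach-sym (from-u x) ◅◅ from-u y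

    size′ : length (T⁻ ++ [ g ]) ≡ _
    size′ = trans (length-++ T⁻) (trans (ℕₚ.+-comm (length T⁻) 1)
                  (trans (sym (length-removeAt′ T (index e∈T))) size))

deduplicate-⊆ : ∀ {n} (xs : List (V n)) → shortcutAll xs ⊆ xs
deduplicate-⊆ [] = []
deduplicate-⊆ (x ∷ xs) = refl ∷ ⊆-trans (filter-⊆ _ _) (deduplicate-⊆ xs)

-- Steps (5)-(6) of the algorithm: under any metric, the Euler circuit of the doubled tree
-- costs 2·c(T), so each shortcut colour tour costs at most 2·c(T).
module DoubledTree {n : ℕ} {d : V n → V n → ℚ} (met : IsMetric d)
                   {T : List (Edge n)} {W : List (V n)} (euler : IsDoubledEulerCircuit T W) where
  open WalkCost d
  open MetricWalks met

  euler-cost : tourCost d W ≡ edgeCost d T + edgeCost d T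
  euler-cost = begin
    tourCost d W                         ≡⟨ tourCost-edges W ⟩
    edgeCost d (closedWalkSteps W)       ≡⟨ edgeCost-↭ (proj₂ (proj₂ euler)) ⟩
    edgeCost d (proj₁ euler)             ≡⟨ edgeCost-reorient (proj₁ (proj₂ euler)) ⟩
    edgeCost d (T ++ T)                  ≡⟨ edgeCost-++ T T ⟩
    edgeCost d T + edgeCost d T          ∎
    where open ≡-Reasoning

  colour-tour-bound : ∀ col k → tourCost d (shortcutColor col k (shortcutAll W)) ≤ edgeCost d T + edgeCost d T
  colour-tour-bound col k =
    ≤-trans (tour-shortcut (⊆-trans (filter-⊆ _ _) (deduplicate-⊆ W))) (≤-reflexive euler-cost)

tree-edge-on-circuit : ∀ {n} {T : List (Edge n)} {W} → IsDoubledEulerCircuit T W →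
                       ∀ {s} → s ∈ T → (proj₁ s ∈ W) × (proj₂ s ∈ W)
tree-edge-on-circuit {T = T} {W} (D , D≈T++T , steps↭D) s∈T with pointwise-∈ D≈T++T (∈-++⁺ˡ {ys = T} s∈T)
... | d , d∈D , inj₁ refl = closedWalkSteps-ends W (∈-resp-↭ (↭-sym steps↭D) d∈D)
... | d , d∈D , inj₂ refl = Product.swap (closedWalkSteps-ends W (∈-resp-↭ (↭-sym steps↭D) d∈D))

-- The circuit of a connected T visits every node: each node has an incident tree edge,
-- namely the first edge of a walk to its partner.
euler-visits-all : ∀ {n} {T : List (Edge n)} {W} → Connected T → IsDoubledEulerCircuit T W → ∀ x → x ∈ W
euler-visits-all {T = T} {W} conn euler x = leaves (partner-≢ x) (conn x (partner x))
  where
  leaves : ∀ {y} → x ≢ y → Reach T x y → x ∈ W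
  leaves x≢x ε = ⊥-elim (x≢x refl)
  leaves _ (inj₁ xz∈T ◅ _) = proj₁ (tree-edge-on-circuit euler xz∈T)
  leaves _ (inj₂ zx∈T ◅ _) = proj₂ (tree-edge-on-circuit euler zx∈T)

two-paths-spanning : ∀ {n} {col : V n → Color} {r₀ Rs b₀ Bs a b} →
  IsTourOn col red (r₀ ∷ Rs) → IsTourOn col blue (b₀ ∷ Bs) → col a ≡ red → col b ≡ blue →
  IsSpanningTree (consecutive (r₀ ∷ Rs) ++ consecutive (b₀ ∷ Bs) ++ [ (a , b) ])
two-paths-spanning {n} {col} {r₀} {Rs} {b₀} {Bs} {a} {b} tR tB red-a blue-b = connected , size
  where
  PR = consecutive (r₀ ∷ Rs)
  PB = consecutive (b₀ ∷ Bs)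

  in-R : ∀ {s} → s ∈ PR → s ∈ PR ++ PB ++ [ (a , b) ]
  in-R = ∈-++⁺ˡ
  in-B : ∀ {s} → s ∈ PB → s ∈ PR ++ PB ++ [ (a , b) ]
  in-B s∈PB = ∈-++⁺ʳ PR (∈-++⁺ˡ s∈PB)

  bridge : Adj (PR ++ PB ++ [ (a , b) ]) a b
  bridge = inj₁ (∈-++⁺ʳ PR (∈-++⁺ʳ PB (here refl)))

  from-r₀ : ∀ y → Reach (PR ++ PB ++ [ (a , b) ]) r₀ y
  from-r₀ y with col y in col-y
  ... | red = Reach-mono in-R (path-reach r₀ Rs (proj₂ (proj₂ tR y) col-y))
  ... | blue = Reach-mono in-R (path-reach r₀ Rs (proj₂ (proj₂ tR a) red-a))
               ◅◅ (bridge ◅ ε)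
               ◅◅ Reach-mono in-B (Reach-sym (path-reach b₀ Bs (proj₂ (proj₂ tB b) blue-b))
                                   ◅◅ path-reach b₀ Bs (proj₂ (proj₂ tB y) col-y))

  connected : Connected (PR ++ PB ++ [ (a , b) ])
  connected x y = Reach-sym (from-r₀ x) ◅◅ from-r₀ y

  size : length (PR ++ PB ++ [ (a , b) ]) ≡ 2 ℕ.* n ∸ 1
  size = begin
    length (PR ++ PB ++ [ (a , b) ])             ≡⟨ length-++ PR ⟩
    length PR ℕ.+ length (PB ++ [ (a , b) ])     ≡⟨ cong (length PR ℕ.+_) (length-++ PB) ⟩
    length PR ℕ.+ (length PB ℕ.+ 1)              ≡⟨ cong₂ (λ r s → r ℕ.+ (s ℕ.+ 1))
                                                          (length-consecutive r₀ Rs) (length-consecutive b₀ Bs) ⟩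
    length Rs ℕ.+ (length Bs ℕ.+ 1)              ≡⟨ cong (length Rs ℕ.+_) (ℕₚ.+-comm (length Bs) 1) ⟩
    length Rs ℕ.+ suc (length Bs)                ≡⟨ cong (_∸ 1) (tours-size tR tB) ⟩
    2 ℕ.* n ∸ 1                                  ∎
    where open ≡-Reasoning

red-blue-edge : ∀ {n} {T : List (Edge n)} {col : V n → Color} {x y} →
  Reach T x y → col x ≡ red → col y ≡ blue → ∃₂ λ a b → Adj T a b × (col a ≡ red) × (col b ≡ blue)
red-blue-edge ε red-x blue-x with trans (sym red-x) blue-x
... | ()
red-blue-edge {col = col} {x} (_◅_ {j = z} adj path) red-x blue-y with col z in col-z
... | blue = x , z , adj , red-x , col-z
... | red = red-blue-edge path col-z blue-y

two-paths-bound : ∀ {n} {c : V n → V n → ℚ} {T} {M} {col : V n → Color} {r₀ Rs b₀ Bs} →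
  IsMetric c → IsMST c T → (∀ e′ → e′ ∈ T → weight c e′ ≤ M) →
  IsTourOn col red (r₀ ∷ Rs) → IsTourOn col blue (b₀ ∷ Bs) →
  edgeCost c T ≤ pathCost c (r₀ ∷ Rs) + pathCost c (b₀ ∷ Bs) + M
two-paths-bound {c = c} {T} {M} {col} {r₀} {Rs} {b₀} {Bs} met ((conn , _) , minimal) ≤M tR tB
  with red-blue-edge (conn r₀ b₀) (proj₁ (proj₂ tR r₀) (here refl)) (proj₁ (proj₂ tB b₀) (here refl))
... | a , b , adj , red-a , blue-b = begin
  edgeCost c T
    ≤⟨ minimal _ (two-paths-spanning tR tB red-a blue-b) ⟩
  edgeCost c (PR ++ PB ++ [ (a , b) ])
    ≡⟨ trans (edgeCost-++ PR _) (cong (λ z → edgeCost c PR + z) (edgeCost-++ PB [ (a , b) ])) ⟩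
  edgeCost c PR + (edgeCost c PB + (c a b + 0ℚ))
    ≡⟨ cong₂ (λ r s → r + (s + (c a b + 0ℚ))) (pathCost-edges (r₀ ∷ Rs)) (pathCost-edges (b₀ ∷ Bs)) ⟨
  pathCost c (r₀ ∷ Rs) + (pathCost c (b₀ ∷ Bs) + (c a b + 0ℚ))
    ≡⟨ cong (λ z → pathCost c (r₀ ∷ Rs) + (pathCost c (b₀ ∷ Bs) + z)) (+-identityʳ (c a b)) ⟩
  pathCost c (r₀ ∷ Rs) + (pathCost c (b₀ ∷ Bs) + c a b)
    ≡⟨ +-assoc (pathCost c (r₀ ∷ Rs)) _ _ ⟨
  pathCost c (r₀ ∷ Rs) + pathCost c (b₀ ∷ Bs) + c a b
    ≤⟨ +-monoʳ-≤ (pathCost c (r₀ ∷ Rs) + pathCost c (b₀ ∷ Bs)) ab≤M ⟩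
  pathCost c (r₀ ∷ Rs) + pathCost c (b₀ ∷ Bs) + M
    ∎
  where
  open ≤-Reasoning
  open WalkCost c using (edgeCost-++; pathCost-edges)
  PR = consecutive (r₀ ∷ Rs)
  PB = consecutive (b₀ ∷ Bs)

  ab≤M : c a b ≤ M
  ab≤M = Sum.[ ≤M _ , (λ ba∈T → subst (_≤ M) (IsMetric.symmetric met b a) (≤M _ ba∈T)) ] adj

module StepRotation {n : ℕ} (d : V n → V n → ℚ) where
  open WalkCost d

  rotate-at : ∀ {a b} pre L suf → closedWalkSteps L ≡ pre ++ (a , b) ∷ suf →
              ∃ λ M → ((b ∷ M) ↭ L) × (tourCost d L ≡ pathCost d (b ∷ M) + d a b)
  rotate-at [] (x ∷ []) suf refl = [] , refl , trans (+-identityʳ (d x x)) (sym (+-identityˡ (d x x)))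
  rotate-at [] (x ∷ y ∷ ys) suf refl = ys ++ [ x ] , ++-comm (y ∷ ys) [ x ] , +-comm (d x y) _
  rotate-at (_ ∷ []) (x ∷ []) suf ()
  rotate-at (_ ∷ _ ∷ _) (x ∷ []) suf ()
  rotate-at {a} {b} (s ∷ pre) (x ∷ y ∷ ys) suf steps with ∷-injective steps
  ... | refl , rest with rotate-at pre (y ∷ ys ++ [ x ]) (suf ++ [ (x , y) ]) rotated
    where
    rotated : closedWalkSteps (y ∷ ys ++ [ x ]) ≡ pre ++ (a , b) ∷ (suf ++ [ (x , y) ])
    rotated = trans (closedWalkSteps-rotate₁ x y ys)
                    (trans (cong (_++ [ (x , y) ]) rest) (++-assoc pre ((a , b) ∷ suf) [ (x , y) ]))
  ... | M , bM↭ , cost = M , ↭-trans bM↭ (++-comm (y ∷ ys) [ x ]) , trans (tourCost-rotate₁ x (y ∷ ys)) cost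

  rotate-to-step : ∀ {a b} L → (a , b) ∈ closedWalkSteps L →
                   ∃ λ M → ((b ∷ M) ↭ L) × (tourCost d L ≡ pathCost d (b ∷ M) + d a b)
  rotate-to-step L ab∈L with ∈-∃++ ab∈L
  ... | pre , suf , steps = rotate-at pre L suf steps

-- Suppose col colours the side of u blue and the side of v
-- red, so that every edge of T⁻ is monochromatic. Contracting all nodes not of colour k to
-- one node of the appropriate side turns the colour-k tour into a shortcut of the doubled
-- tree under a contracted metric; the two contracted metrics together weigh T at most
-- c(T⁻). Hence the two colour tours cost at most 2·c(T⁻) (the bound 2·(c(T_L) + c(T_R))).
module SplitBound {n : ℕ} {c : V n → V n → ℚ} (met : IsMetric c)
                  {T : List (Edge n)} {W : List (V n)} (euler : IsDoubledEulerCircuit T W)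
                  {u v : V n} (e∈T : (u , v) ∈ T) (col : V n → Color)
                  (blue-u : col u ≡ blue) (red-v : col v ≡ red)
                  (monochromatic : ∀ s → s ∈ (T ─ e∈T) → col (proj₁ s) ≡ col (proj₂ s))
                  (W-complete : ∀ x → x ∈ W)
                  (two-nodes : ∀ k → ∃₂ λ x y → (x ≢ y) × (col x ≡ k) × (col y ≡ k)) where
  open ZeroDiagonal met

  contract : Color → V n → V n → V n
  contract k a x with col x ≟C k
  ... | yes _ = x
  ... | no _ = a

  contract-kept : ∀ {k a x} → col x ≡ k → contract k a x ≡ x
  contract-kept {k} {a} {x} col-x with col x ≟C k
  ... | yes _ = refl
  ... | no col-x≢k = ⊥-elim (col-x≢k col-x)

  contract-sent : ∀ {k a x} → col x ≢ k → contract k a x ≡ a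
  contract-sent {k} {a} {x} col-x≢k with col x ≟C k
  ... | yes col-x = ⊥-elim (col-x≢k col-x)
  ... | no _ = refl

  contracted : Color → V n → V n → V n → ℚ
  contracted k a x y = zeroDiagonal c (contract k a x) (contract k a y)

  contracted-metric : ∀ k a → IsMetric (contracted k a)
  contracted-metric k a = pullback-metric zeroDiagonal-metric (contract k a)

  contracted-inside : ∀ {k a x y} → col x ≡ k → col y ≡ k → contracted k a x y ≤ c x y
  contracted-inside col-x col-y =
    subst₂ (λ p q → zeroDiagonal c p q ≤ _) (sym (contract-kept col-x)) (sym (contract-kept col-y))
           (zeroDiagonal-≤ _ _)

  contracted-merged : ∀ {k a x y} → contract k a x ≡ a → contract k a y ≡ a → contracted k a x y ≡ 0ℚ
  contracted-merged {a = a} x↦a y↦a = trans (cong₂ (zeroDiagonal c) x↦a y↦a) (zeroDiagonal-refl c a)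

  colour-tour : Color → List (V n)
  colour-tour k = shortcutColor col k (shortcutAll W)

  in-tour : ∀ {k z} → col z ≡ k → z ∈ colour-tour k
  in-tour {z = z} col-z = ∈-filter⁺ _ (∈-deduplicate⁺ _≟V_ (W-complete z)) col-z

  tour-colour : ∀ {k z} → z ∈ colour-tour k → col z ≡ k
  tour-colour {k} z∈ = proj₂ (∈-filter⁻ (λ z → col z ≟C k) {xs = shortcutAll W} z∈)

  tour-unique : ∀ k → Unique (colour-tour k)
  tour-unique k = Unique.filter⁺ _ (deduplicate-! _≟V_ W)

  -- The colour-k tour costs no more under c than under the contracted metric: its steps join
  -- distinct colour-k nodes, where the two agree.
  colour-tour-contracted : ∀ k a → tourCost c (colour-tour k) ≤ tourCost (contracted k a) (colour-tour k)
  colour-tour-contracted k a with two-nodes k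
  ... | x , y , x≢y , col-x , col-y
      with two-entries (in-tour col-x) (in-tour col-y) x≢y
  ... | p , q , qs , tour≡ = subst₂ _≤_ (cost c) (cost (contracted k a))
          (edgeCost-mono (closedWalkSteps (colour-tour k)) step-agrees)
    where
    cost : ∀ d → edgeCost d (closedWalkSteps (colour-tour k)) ≡ tourCost d (colour-tour k)
    cost d = sym (WalkCost.tourCost-edges d (colour-tour k))

    step-agrees : ∀ s → s ∈ closedWalkSteps (colour-tour k) → weight c s ≤ weight (contracted k a) s
    step-agrees (z , w) s∈ = ≤-reflexive (sym (begin
      zeroDiagonal c (contract k a z) (contract k a w)
        ≡⟨ cong₂ (zeroDiagonal c) (contract-kept (tour-colour z∈)) (contract-kept (tour-colour w∈)) ⟩
      zeroDiagonal c z w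
        ≡⟨ zeroDiagonal-≢ c z≢w ⟩
      c z w
        ∎))
      where
      open ≡-Reasoning
      z∈ = proj₁ (closedWalkSteps-ends (colour-tour k) s∈)
      w∈ = proj₂ (closedWalkSteps-ends (colour-tour k) s∈)
      z≢w = closedWalkSteps-distinct p q qs (subst Unique tour≡ (tour-unique k))
                                            (subst (λ L → (z , w) ∈ closedWalkSteps L) tour≡ s∈)

  -- The blue tour lives on u's side, with the red side merged into u; symmetrically for red.
  d-blue d-red : V n → V n → ℚ
  d-blue = contracted blue u
  d-red = contracted red v

  -- A monochromatic tree edge is weighed by at most one of the two contracted metrics.
  tree-edge-split : ∀ s → s ∈ (T ─ e∈T) → weight d-blue s + weight d-red s ≤ weight c s
  tree-edge-split (x , y) s∈ = by-colour (col x) refl (sym (monochromatic _ s∈))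
    where
    by-colour : ∀ k → col x ≡ k → col y ≡ k → d-blue x y + d-red x y ≤ c x y
    by-colour blue col-x col-y =
      subst (_≤ c x y) (sym (trans (cong (λ z → d-blue x y + z) red-merged) (+-identityʳ _))) (contracted-inside col-x col-y)
      where
      red-merged : d-red x y ≡ 0ℚ
      red-merged = contracted-merged (contract-sent (blue≢red col-x)) (contract-sent (blue≢red col-y))
    by-colour red col-x col-y =
      subst (_≤ c x y) (sym (trans (cong (_+ d-red x y) blue-merged) (+-identityˡ _))) (contracted-inside col-x col-y)
      where
      blue-merged : d-blue x y ≡ 0ℚ
      blue-merged = contracted-merged (contract-sent (red≢blue col-x)) (contract-sent (red≢blue col-y))

  deleted-edge-split : d-blue u v + d-red u v ≡ 0ℚ
  deleted-edge-split =
    trans (cong₂ _+_ (contracted-merged (contract-kept blue-u) (contract-sent (red≢blue red-v)))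
                     (contracted-merged (contract-sent (blue≢red blue-u)) (contract-kept red-v)))
          (+-identityˡ 0ℚ)

  contracted-tree-bound : edgeCost d-blue T + edgeCost d-red T ≤ edgeCost c (T ─ e∈T)
  contracted-tree-bound = begin
    edgeCost d-blue T + edgeCost d-red T                   ≡⟨ edgeCost-+ d-blue d-red T ⟨
    edgeCost d-both T                                      ≡⟨ WalkCost.edgeCost-─ d-both e∈T ⟩
    (d-blue u v + d-red u v) + edgeCost d-both (T ─ e∈T)   ≡⟨ cong (_+ edgeCost d-both (T ─ e∈T)) deleted-edge-split ⟩
    0ℚ + edgeCost d-both (T ─ e∈T)                         ≡⟨ +-identityˡ _ ⟩
    edgeCost d-both (T ─ e∈T)                              ≤⟨ edgeCost-mono (T ─ e∈T) tree-edge-split ⟩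
    edgeCost c (T ─ e∈T)                                   ∎
    where
    open ≤-Reasoning
    d-both : V n → V n → ℚ
    d-both x y = d-blue x y + d-red x y

  split-bound : tourCost c (colour-tour blue) + tourCost c (colour-tour red)
                ≤ edgeCost c (T ─ e∈T) + edgeCost c (T ─ e∈T)
  split-bound = begin
    tourCost c (colour-tour blue) + tourCost c (colour-tour red)
      ≤⟨ +-mono-≤ (colour-tour-contracted blue u) (colour-tour-contracted red v) ⟩
    tourCost d-blue (colour-tour blue) + tourCost d-red (colour-tour red)
      ≤⟨ +-mono-≤ (DoubledTree.colour-tour-bound (contracted-metric blue u) {T} {W} euler col blue)
                  (DoubledTree.colour-tour-bound (contracted-metric red v) {T} {W} euler col red) ⟩
    (edgeCost d-blue T + edgeCost d-blue T) + (edgeCost d-red T + edgeCost d-red T)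
      ≡⟨ interchange (edgeCost d-blue T) _ _ _ ⟩
    (edgeCost d-blue T + edgeCost d-red T) + (edgeCost d-blue T + edgeCost d-red T)
      ≤⟨ +-mono-≤ contracted-tree-bound contracted-tree-bound ⟩
    edgeCost c (T ─ e∈T) + edgeCost c (T ─ e∈T)
      ∎
    where open ≤-Reasoning

at-least-two-pairs : ∀ {n} {T : List (Edge n)} {e} → 2 ∣ n → IsSpanningTree T → e ∈ T → ∃ λ m → n ≡ suc (suc m)
at-least-two-pairs {zero} {[]} _ _ ()
at-least-two-pairs {zero} {_ ∷ _} _ (_ , ()) _
at-least-two-pairs {suc zero} (divides zero ()) _ _
at-least-two-pairs {suc zero} (divides (suc q) ()) _ _
at-least-two-pairs {suc (suc m)} _ _ _ = m , refl

module Analysis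
  {n : ℕ} {c : V n → V n → ℚ} (met : IsMetric c) {T : List (Edge n)} (mst : IsMST c T)
  {u v : V n} (e∈T : (u , v) ∈ T) (e-max : ∀ e′ → e′ ∈ T → weight c e′ ≤ c u v)
  {col : V n → Color} (valid : ValidColoring col) (split : RespectsSplit T e∈T col)
  {W : List (V n)} (euler : IsDoubledEulerCircuit T W)
  {col′ : V n → Color} (valid′ : ValidColoring col′)
  {r₀ b₀ : V n} {Rs Bs : List (V n)} (tR : IsTourOn col′ red (r₀ ∷ Rs)) (tB : IsTourOn col′ blue (b₀ ∷ Bs))
  {i₀ i₁ : Fin n} (i₀≢i₁ : i₀ ≢ i₁) where

  open DeleteEdge T e∈T
  open WalkCost c using (edgeCost-─)
  open MetricWalks met using (path≤tour; tourCost-nonneg)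

  R B : List (V n)
  R = r₀ ∷ Rs
  B = b₀ ∷ Bs

  ALG OPT : ℚ
  ALG = tourCost c (shortcutColor col blue (shortcutAll W)) + tourCost c (shortcutColor col red (shortcutAll W))
  OPT = tourCost c R + tourCost c B

  conn : Connected T
  conn = proj₁ (proj₁ mst)

  alg≤4·tree : ALG ≤ (edgeCost c T + edgeCost c T) + (edgeCost c T + edgeCost c T)
  alg≤4·tree = +-mono-≤ (DoubledTree.colour-tour-bound met {T} {W} euler col blue)
                        (DoubledTree.colour-tour-bound met {T} {W} euler col red)

  forest≤OPT : edgeCost c T⁻ ≤ OPT
  forest≤OPT = ≤-trans (+-cancelˡ-≤ (c u v) _ _ (begin
      c u v + edgeCost c T⁻                     ≡⟨ edgeCost-─ e∈T ⟨
      edgeCost c T                              ≤⟨ two-paths-bound met mst e-max tR tB ⟩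
      pathCost c R + pathCost c B + c u v       ≡⟨ +-comm _ (c u v) ⟩
      c u v + (pathCost c R + pathCost c B)     ∎))
    (+-mono-≤ (path≤tour r₀ Rs) (path≤tour b₀ Bs))
    where open ≤-Reasoning

  ReconnectingStep : Set
  ReconnectingStep = ∃ λ s → ((s ∈ closedWalkSteps R) ⊎ (s ∈ closedWalkSteps B)) × Reconnects s

  -- Such a step is at least as heavy as the deleted edge; dropping it from its tour leaves a
  -- Hamiltonian path, so two-paths-bound gives c(T) ≤ OPT.
  reconnecting⇒tree≤OPT : ReconnectingStep → edgeCost c T ≤ OPT
  reconnecting⇒tree≤OPT ((a , b) , inj₁ ab∈R , reconnect) with StepRotation.rotate-to-step c R ab∈R
  ... | M , bM↭R , tour-R = begin
    edgeCost c T                                ≤⟨ two-paths-bound met mst e-max (tour-resp-↭ (↭-sym bM↭R) tR) tB ⟩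
    pathCost c (b ∷ M) + pathCost c B + c u v   ≤⟨ +-monoʳ-≤ (pathCost c (b ∷ M) + pathCost c B) (exchange c mst _ reconnect) ⟩
    pathCost c (b ∷ M) + pathCost c B + c a b   ≡⟨ xy∙z≈xz∙y (pathCost c (b ∷ M)) _ _ ⟩
    pathCost c (b ∷ M) + c a b + pathCost c B   ≡⟨ cong (_+ pathCost c B) tour-R ⟨
    tourCost c R + pathCost c B                 ≤⟨ +-monoʳ-≤ (tourCost c R) (path≤tour b₀ Bs) ⟩
    OPT                                         ∎
    where open ≤-Reasoning
  reconnecting⇒tree≤OPT ((a , b) , inj₂ ab∈B , reconnect) with StepRotation.rotate-to-step c B ab∈B
  ... | M , bM↭B , tour-B = begin
    edgeCost c T                                ≤⟨ two-paths-bound met mst e-max tR (tour-resp-↭ (↭-sym bM↭B) tB) ⟩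
    pathCost c R + pathCost c (b ∷ M) + c u v   ≤⟨ +-monoʳ-≤ (pathCost c R + pathCost c (b ∷ M)) (exchange c mst _ reconnect) ⟩
    pathCost c R + pathCost c (b ∷ M) + c a b   ≡⟨ +-assoc (pathCost c R) _ _ ⟩
    pathCost c R + (pathCost c (b ∷ M) + c a b) ≡⟨ cong (λ z → pathCost c R + z) tour-B ⟨
    pathCost c R + tourCost c B                 ≤⟨ +-monoˡ-≤ (tourCost c B) (path≤tour r₀ Rs) ⟩
    OPT                                         ∎
    where open ≤-Reasoning

  -- Without a reconnecting step, every pair is split by the deleted edge, so col is the
  -- colouring of step (3) on all nodes, and the split bound applies.
  module NoReconnection (none : ¬ ReconnectingStep) where

    Steady : List (Edge n) → Set
    Steady E = ∀ {s} → s ∈ E → ¬ Reconnects s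

    R-steady : Steady (closedWalkSteps R)
    R-steady s∈R reconnect = none (_ , inj₁ s∈R , reconnect)

    B-steady : Steady (closedWalkSteps B)
    B-steady s∈B reconnect = none (_ , inj₂ s∈B , reconnect)

    -- u and v are on different sides, since otherwise every step would reconnect.
    sides-apart : ¬ Left v
    sides-apart uv with some-step r₀ Rs
    ... | s , s∈R = R-steady s∈R (Reach-mono ∈-++⁺ˡ uv)

    left-not-right : ∀ {x} → Left x → Right x → ⊥
    left-not-right ux vx = sides-apart (ux ◅◅ Reach-sym vx)

    cannot-cross : ∀ {E x y} → Steady E → Adj E x y → Left x → Right y → ⊥
    cannot-cross steady (inj₁ xy∈E) ux vy = steady xy∈E (crossing-reconnects (inj₁ (ux , vy)))
    cannot-cross steady (inj₂ yx∈E) ux vy = steady yx∈E (crossing-reconnects (inj₂ (vy , ux)))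

    stays-left : ∀ {E x y} → Steady E → Reach E x y → Left x → Left y
    stays-left steady ε ux = ux
    stays-left steady (adj ◅ path) ux =
      stays-left steady path (Sum.[ id , (λ vz → ⊥-elim (cannot-cross steady adj ux vz)) ] (sides conn _))

    stays-right : ∀ {E x y} → Steady E → Reach E x y → Right x → Right y
    stays-right steady ε vx = vx
    stays-right steady (adj ◅ path) vx =
      stays-right steady path (Sum.[ (λ uz → ⊥-elim (cannot-cross steady (Adj-sym adj) uz vx)) , id ] (sides conn _))

    OnSide : (V n → Set) → List (V n) → Set
    OnSide S L = ∀ y → y ∈ L → S y

    tour-one-side : ∀ x xs → Steady (closedWalkSteps (x ∷ xs)) → OnSide Left (x ∷ xs) ⊎ OnSide Right (x ∷ xs)
    tour-one-side x xs steady = Sum.map (λ ux y y∈ → stays-left path-steady (path-reach x xs y∈) ux)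
                                        (λ vx y y∈ → stays-right path-steady (path-reach x xs y∈) vx)
                                        (sides conn x)
      where
      path-steady : Steady (consecutive (x ∷ xs))
      path-steady s∈ = steady (path-steps-⊆ x xs s∈)

    in-R⊎B : ∀ x → (x ∈ R) ⊎ (x ∈ B)
    in-R⊎B x with col′ x in col′-x
    ... | red = inj₁ (proj₂ (proj₂ tR x) col′-x)
    ... | blue = inj₂ (proj₂ (proj₂ tB x) col′-x)

    partner-R : ∀ {x} → x ∈ R → partner x ∈ B
    partner-R {x} x∈R =
      proj₂ (proj₂ tB (partner x)) (partner-other {col = col′} valid′ (red≢blue (proj₁ (proj₂ tR x) x∈R)))

    partner-B : ∀ {x} → x ∈ B → partner x ∈ R
    partner-B {x} x∈B =
      proj₂ (proj₂ tR (partner x)) (partner-other {col = col′} valid′ (blue≢red (proj₁ (proj₂ tB x) x∈B)))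

    PairsSplit : Set
    PairsSplit = ∀ x → (Left x → Right (partner x)) × (Right x → Left (partner x))

    opposite-sides : ∀ {P Q} → OnSide Left P → OnSide Right Q → (∀ x → (x ∈ P) ⊎ (x ∈ Q)) →
                     (∀ {x} → x ∈ P → partner x ∈ Q) → (∀ {x} → x ∈ Q → partner x ∈ P) → PairsSplit
    opposite-sides P-left Q-right cover P→Q Q→P x with cover x
    ... | inj₁ x∈P = (λ _ → Q-right _ (P→Q x∈P)) , (λ vx → ⊥-elim (left-not-right (P-left x x∈P) vx))
    ... | inj₂ x∈Q = (λ ux → ⊥-elim (left-not-right ux (Q-right x x∈Q))) , (λ _ → P-left _ (Q→P x∈Q))

    pairs-split : PairsSplit
    pairs-split with tour-one-side r₀ Rs R-steady | tour-one-side b₀ Bs B-steady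
    ... | inj₁ R-left | inj₂ B-right = opposite-sides R-left B-right in-R⊎B partner-R partner-B
    ... | inj₂ R-right | inj₁ B-left = opposite-sides B-left R-right (λ x → Sum.swap (in-R⊎B x)) partner-B partner-R
    ... | inj₁ R-left | inj₁ B-left = ⊥-elim (sides-apart (Sum.[ R-left v , B-left v ] (in-R⊎B v)))
    ... | inj₂ R-right | inj₂ B-right = ⊥-elim (left-not-right ε (Sum.[ R-right u , B-right u ] (in-R⊎B u)))

    left-blue : ∀ {x} → Left x → col x ≡ blue
    left-blue {i , b} ux = proj₁ (split i b ux (proj₁ (pairs-split (i , b)) ux))

    right-red : ∀ {x} → Right x → col x ≡ red
    right-red {i , b} vx = subst (λ b′ → col (i , b′) ≡ red) (not-involutive b)
      (proj₂ (split i (not b) (proj₂ (pairs-split (i , b)) vx)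
                              (subst (λ b′ → Right (i , b′)) (sym (not-involutive b)) vx)))

    -- So every edge of T⁻, lying on one side, is monochromatic.
    monochromatic : ∀ s → s ∈ T⁻ → col (proj₁ s) ≡ col (proj₂ s)
    monochromatic (a , b) ab∈T⁻ with sides conn a
    ... | inj₁ ua = trans (left-blue ua) (sym (left-blue (ua ◅◅ (inj₁ ab∈T⁻ ◅ ε))))
    ... | inj₂ va = trans (right-red va) (sym (right-red (va ◅◅ (inj₁ ab∈T⁻ ◅ ε))))

    alg≤2·forest : ALG ≤ edgeCost c T⁻ + edgeCost c T⁻
    alg≤2·forest =
      SplitBound.split-bound met {T} {W} euler e∈T col (left-blue ε) (right-red ε) monochromatic
                             (euler-visits-all {T = T} {W} conn euler) (two-of-each-colour {col = col} valid i₀≢i₁)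

  -- Combining the two cases (the case split is classical, but the goal is decidable).
  approximation : ALG ≤ (+ 4) / 1 * OPT
  approximation = decidable-stable (ALG ≤? (+ 4) / 1 * OPT)
                                   (λ ¬bound → ¬¬-excluded-middle (λ dec → ¬bound (by-cases dec)))
    where
    open ≤-Reasoning

    OPT-nonneg : 0ℚ ≤ OPT
    OPT-nonneg = +-nonneg (tourCost-nonneg R) (tourCost-nonneg B)

    by-cases : Dec ReconnectingStep → ALG ≤ (+ 4) / 1 * OPT
    by-cases (yes step) = begin
      ALG                                                            ≤⟨ alg≤4·tree ⟩
      (edgeCost c T + edgeCost c T) + (edgeCost c T + edgeCost c T)  ≤⟨ +-mono-≤ twice twice ⟩
      (OPT + OPT) + (OPT + OPT)                                      ≡⟨ four-times OPT ⟨
      (+ 4) / 1 * OPT                                                ∎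
      where
      twice : edgeCost c T + edgeCost c T ≤ OPT + OPT
      twice = +-mono-≤ (reconnecting⇒tree≤OPT step) (reconnecting⇒tree≤OPT step)
    by-cases (no none) = begin
      ALG                                        ≤⟨ NoReconnection.alg≤2·forest none ⟩
      edgeCost c T⁻ + edgeCost c T⁻              ≤⟨ +-mono-≤ forest≤OPT forest≤OPT ⟩
      OPT + OPT                                  ≤⟨ ≤-+-nonneg (OPT + OPT) (+-nonneg OPT-nonneg OPT-nonneg) ⟩
      (OPT + OPT) + (OPT + OPT)                  ≡⟨ four-times OPT ⟨
      (+ 4) / 1 * OPT                            ∎

-- Theorem 5: Algorithm 2 is a 4-approximation for min-sum 2-TSP. The instance has at least
-- two pairs, so both tours of the compared solution are nonempty, and the analysis applies.
theorem5 : (n : ℕ) → 2 ∣ n →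
    (c : V n → V n → ℚ) → IsMetric c →
    (T : List (Edge n)) → IsMST c T →
    (e : Edge n) (e∈T : e ∈ T) → (∀ e′ → e′ ∈ T → weight c e′ ≤ weight c e) →
    (col : V n → Color) → ValidColoring col → RespectsSplit T e∈T col →
    (W : List (V n)) → IsDoubledEulerCircuit T W →
    (col′ : V n → Color) → ValidColoring col′ →
    (R B : List (V n)) → IsTourOn col′ red R → IsTourOn col′ blue B →
    tourCost c (shortcutColor col blue (shortcutAll W)) + tourCost c (shortcutColor col red (shortcutAll W))
    ≤ ((+ 4) / 1) * (tourCost c R + tourCost c B)
theorem5 n even c met T mst e e∈T e-max col valid split W euler col′ valid′ R B tR tB
  with at-least-two-pairs even (proj₁ mst) e∈T
... | m , refl with tour-nonempty {col = col′} valid′ Fin.zero tR | tour-nonempty {col = col′} valid′ Fin.zero tB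
... | r₀ , Rs , refl | b₀ , Bs , refl =
  Analysis.approximation met mst e∈T e-max valid split {W = W} euler valid′ tR tB
                         {Fin.zero} {Fin.suc Fin.zero} (λ ())
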